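{- Let $G$ be a finite simple graph. Then there exists $E_0\subseteq E(G)$ such that $\mathcal{M}(E_0)=\{m_e: e\in E_0\}$ is an isolating set of $\mathrm{Mid}(G)$ and $|\mathcal{M}(E_0)|=\iota(\mathrm{Mid}(G))$.
   Context: For a graph $H$ and $S\subseteq V(H)$, let $N_H[S]$ be $S$ together with all vertices adjacent to a vertex of $S$. A set $S\subseteq V(H)$ is an isolating set of $H$ if $V(H)\setminus N_H[S]$ is an independent set of $H$; $\iota(H)$ is the minimum size of an isolating set of $H$. The middle graph $\mathrm{Mid}(G)$ has vertex set $V(G)\cup\{m_e: e\in E(G)\}$, with $v\sim m_e$ iff $v$ is an endpoint of $e$, $m_e\sim m_f$ iff distinct edges $e,f$ share an endpoint, and no edges between vertices of $V(G)$. -}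

module Defs where

open import Data.Nat using (ℕ; _≤_)
open import Data.Fin using (Fin; _<_)
open import Data.Bool using (Bool; true; false; T)
open import Data.Product using (Σ; ∃; _×_; _,_; proj₁; proj₂)
open import Data.Sum using (_⊎_; inj₁; inj₂)
open import Data.List using (List; map; length)
open import Data.List.Membership.Propositional using (_∈_)
open import Data.List.Relation.Unary.Unique.Propositional using (Unique)
open import Relation.Binary.PropositionalEquality using (_≡_; _≢_)
open import Relation.Nullary using (¬_)

record Graph (n : ℕ) : Set where
  field
    adj   : Fin n → Fin n → Bool
    sym   : ∀ i j → adj i j ≡ adj j i
    irrefl : ∀ i → adj i i ≡ false

open Graph public

-- Edges: each edge {i,j} represented once, as the pair (i , j) with i < j.
Edge : ∀ {n} → Graph n → Set
Edge {n} G = Σ (Fin n × Fin n) λ p → (proj₁ p < proj₂ p) × T (adj G (proj₁ p) (proj₂ p))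

Endpoint : ∀ {n} {G : Graph n} → Fin n → Edge G → Set
Endpoint v ((i , j) , _) = (v ≡ i) ⊎ (v ≡ j)

ShareEnd : ∀ {n} {G : Graph n} → Edge G → Edge G → Set
ShareEnd {G = G} e f = ∃ λ v → Endpoint {G = G} v e × Endpoint {G = G} v f

-- Vertex set of the middle graph: V(G) ⊎ {m_e : e ∈ E(G)}
MidV : ∀ {n} → Graph n → Set
MidV {n} G = Fin n ⊎ Edge G

m : ∀ {n} {G : Graph n} → Edge G → MidV G
m e = inj₂ e

MidAdj : ∀ {n} (G : Graph n) → MidV G → MidV G → Set
MidAdj G (inj₁ u) (inj₁ v) = Data.Empty.⊥
  where import Data.Empty
MidAdj G (inj₁ v) (inj₂ e) = Endpoint {G = G} v e
MidAdj G (inj₂ e) (inj₁ v) = Endpoint {G = G} v e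
MidAdj G (inj₂ e) (inj₂ f) = (e ≢ f) × ShareEnd {G = G} e f

InClosedNbhd : ∀ {n} (G : Graph n) → List (MidV G) → MidV G → Set
InClosedNbhd G S x = ∃ λ s → s ∈ S × ((s ≡ x) ⊎ MidAdj G s x)

IsolatingMid : ∀ {n} (G : Graph n) → List (MidV G) → Set
IsolatingMid G S = ∀ x y → ¬ InClosedNbhd G S x → ¬ InClosedNbhd G S y → ¬ MidAdj G x y

-- S (a duplicate-free list, i.e. a finite set) is a minimum isolating set,
-- i.e. |S| = ι(Mid G)
IsMinIsolatingMid : ∀ {n} (G : Graph n) → List (MidV G) → Set
IsMinIsolatingMid G S =
  Unique S × IsolatingMid G S ×
  (∀ T′ → Unique T′ → IsolatingMid G T′ → length S ≤ length T′)

module Submission where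

-- An isolating set S of Mid(G) can be traded for a set of middle vertices of
-- no larger size: keep each m_e ∈ S, and replace a vertex v ∈ S by m_e for one
-- edge e at v (dropping v if it is isolated in G).  Since N[v] ⊆ N[m_e] for
-- v ∈ e, while an isolated v has no neighbours at all, an edge of Mid(G) with
-- both ends outside the new closed neighbourhood already had both ends outside
-- N[S].  So a smallest isolating set of middle vertices, found by exhaustive
-- search, is a minimum isolating set.

open import Defs
open import Data.Nat using (ℕ; zero; suc; _≤_; z≤n; s≤s)
open import Data.Nat.Properties using (≤-trans; ≤-reflexive; <⇒≤; ≰⇒>; _≤?_; <-irrelevant; +-mono-≤)
open import Data.Fin using (Fin)
open import Data.Fin.Properties using (_≟_; _<?_)
open import Data.Bool.Properties using (T-irrelevant)
open import Data.Product using (∃; _×_; _,_; proj₁)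
open import Data.Product.Properties using (≡-dec)
open import Data.Sum using (inj₁; inj₂; _⊎_)
open import Data.Sum.Properties using (inj₂-injective) renaming (≡-dec to ⊎-≡-dec)
open import Data.Empty using (⊥-elim)
open import Function using (_∘_)
open import Data.List using (List; []; _∷_; map; length; _++_; concatMap; filter; upTo; allFin; cartesianProduct; deduplicate)
open import Data.List.Properties using (length-++; length-map; length-deduplicate)
open import Data.List.Membership.Propositional using (_∈_; find; lose)
open import Data.List.Membership.Propositional.Properties using (∈-map⁺; ∈-++⁺ˡ; ∈-++⁺ʳ; ∈-concatMap⁺; ∈-allFin; ∈-upTo⁺; ∈-cartesianProduct⁺; ∈-filter⁺; ∈-deduplicate⁺)
open import Data.List.Relation.Binary.Subset.Propositional using (_⊆_)
open import Data.List.Relation.Binary.Subset.Propositional.Properties using () renaming (map⁺ to ⊆-map⁺)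
open import Data.List.Relation.Unary.Any using (here; any?)
open import Data.List.Relation.Unary.All as All using (All; all?)
open import Data.List.Relation.Unary.All.Properties using (all-filter)
open import Data.List.Relation.Unary.Unique.Propositional using (Unique)
open import Data.List.Relation.Unary.Unique.Propositional.Properties using () renaming (map⁺ to Unique-map⁺)
open import Data.List.Relation.Unary.Unique.DecPropositional.Properties using (deduplicate-!)
open import Data.List.Extrema.Nat using (argmin; argmin-all; f[argmin]≤f[⊤]; f[argmin]≤f[xs])
open import Relation.Binary.PropositionalEquality using (_≡_; refl)
open import Relation.Nullary using (¬_; Dec; yes; no)
open import Relation.Nullary.Decidable using (T?; _⊎-dec_; _×-dec_; _→-dec_; ¬?)

module _ {A : Set} where

  words : List A → ℕ → List (List A)
  words xs zero    = [] ∷ []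
  words xs (suc k) = concatMap (λ x → map (x ∷_) (words xs k)) xs

  ∈-words : ∀ {xs} ys → All (_∈ xs) ys → ys ∈ words xs (length ys)
  ∈-words []       All.[]       = here refl
  ∈-words (y ∷ ys) (y∈ All.∷ ys∈) =
    ∈-concatMap⁺ (λ x → map (x ∷_) (words _ (length ys))) (lose y∈ (∈-map⁺ (y ∷_) (∈-words ys ys∈)))

  wordsUpTo : List A → ℕ → List (List A)
  wordsUpTo xs k = concatMap (words xs) (upTo (suc k))

  ∈-wordsUpTo : ∀ {xs k ys} → All (_∈ xs) ys → length ys ≤ k → ys ∈ wordsUpTo xs k
  ∈-wordsUpTo {xs} {ys = ys} ys∈ ys≤k =
    ∈-concatMap⁺ (words xs) (lose (∈-upTo⁺ (s≤s ys≤k)) (∈-words ys ys∈))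

module MiddleGraph {n : ℕ} (G : Graph n) where

  mid : Edge G → MidV G
  mid = m {G = G}

  _∈ᴱ_ : Fin n → Edge G → Set
  v ∈ᴱ e = Endpoint {G = G} v e

  Adj : MidV G → MidV G → Set
  Adj = MidAdj G

  N[_] : List (MidV G) → MidV G → Set
  N[ S ] = InClosedNbhd G S

  edge-ext : ∀ {e f : Edge G} → proj₁ e ≡ proj₁ f → e ≡ f
  edge-ext {(i , j) , i<j , ij} {(.i , .j) , i<j′ , ij′} refl
    with refl ← <-irrelevant i<j i<j′ | refl ← T-irrelevant ij ij′ = refl

  _≟ᴱ_ : (e f : Edge G) → Dec (e ≡ f)
  e ≟ᴱ f with ≡-dec _≟_ _≟_ (proj₁ e) (proj₁ f)
  ... | yes e≡f = yes (edge-ext e≡f)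
  ... | no  e≢f = no λ { refl → e≢f refl }

  _≟ⱽ_ : (x y : MidV G) → Dec (x ≡ y)
  _≟ⱽ_ = ⊎-≡-dec _≟_ _≟ᴱ_

  _∈ᴱ?_ : ∀ v e → Dec (v ∈ᴱ e)
  v ∈ᴱ? ((i , j) , _) = (v ≟ i) ⊎-dec (v ≟ j)

  share? : ∀ e f → Dec (ShareEnd {G = G} e f)
  share? e@((i , j) , _) f with i ∈ᴱ? f | j ∈ᴱ? f
  ... | yes i∈f | _       = yes (i , inj₁ refl , i∈f)
  ... | no  _   | yes j∈f = yes (j , inj₂ refl , j∈f)
  ... | no  i∉f | no  j∉f = no λ { (_ , inj₁ refl , i∈f) → i∉f i∈f ; (_ , inj₂ refl , j∈f) → j∉f j∈f }

  adj? : ∀ x y → Dec (Adj x y)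
  adj? (inj₁ u) (inj₁ v) = no λ ()
  adj? (inj₁ v) (inj₂ e) = v ∈ᴱ? e
  adj? (inj₂ e) (inj₁ v) = v ∈ᴱ? e
  adj? (inj₂ e) (inj₂ f) = ¬? (e ≟ᴱ f) ×-dec share? e f

  adj-sym : ∀ {x y} → Adj x y → Adj y x
  adj-sym {inj₁ v} {inj₂ e} v∈e = v∈e
  adj-sym {inj₂ e} {inj₁ v} v∈e = v∈e
  adj-sym {inj₂ e} {inj₂ f} (e≢f , v , v∈e , v∈f) = (λ { refl → e≢f refl }) , v , v∈f , v∈e

  N?[_] : ∀ S x → Dec (N[ S ] x)
  N?[ S ] x with any? (λ s → (s ≟ⱽ x) ⊎-dec adj? s x) S
  ... | yes s∈ = yes (find s∈)
  ... | no  s∉ = no λ (s , s∈S , r) → s∉ (lose s∈S r)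

  edgesAt : Fin n × Fin n → List (Edge G)
  edgesAt (i , j) with i <? j | T? (adj G i j)
  ... | yes i<j | yes ij = ((i , j) , i<j , ij) ∷ []
  ... | _       | _      = []

  ∈-edgesAt : ∀ e → e ∈ edgesAt (proj₁ e)
  ∈-edgesAt ((i , j) , i<j , ij) with i <? j | T? (adj G i j)
  ... | yes _   | yes _  = here (edge-ext refl)
  ... | no  i≮j | _      = ⊥-elim (i≮j i<j)
  ... | yes _   | no ¬ij = ⊥-elim (¬ij ij)

  edges : List (Edge G)
  edges = concatMap edgesAt (cartesianProduct (allFin n) (allFin n))

  ∈-edges : ∀ e → e ∈ edges
  ∈-edges e@((i , j) , _) =
    ∈-concatMap⁺ edgesAt (lose (∈-cartesianProduct⁺ (∈-allFin i) (∈-allFin j)) (∈-edgesAt e))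

  vertices : List (MidV G)
  vertices = map inj₁ (allFin n) ++ map mid edges

  ∈-vertices : ∀ x → x ∈ vertices
  ∈-vertices (inj₁ v) = ∈-++⁺ˡ (∈-map⁺ inj₁ (∈-allFin v))
  ∈-vertices (inj₂ e) = ∈-++⁺ʳ (map inj₁ (allFin n)) (∈-map⁺ mid (∈-edges e))

  isolating? : ∀ S → Dec (IsolatingMid G S)
  isolating? S
    with all? (λ x → all? (λ y → ¬? (N?[ S ] x) →-dec ¬? (N?[ S ] y) →-dec ¬? (adj? x y)) vertices) vertices
  ... | yes ok  = yes λ x y → All.lookup (All.lookup ok (∈-vertices x)) (∈-vertices y)
  ... | no  ¬ok = no λ iso → ¬ok (All.tabulate λ {x} _ → All.tabulate λ {y} _ → iso x y)

  isolating-⊆ : ∀ {S S′} → S ⊆ S′ → IsolatingMid G S → IsolatingMid G S′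
  isolating-⊆ S⊆S′ iso x y x∉ y∉ =
    iso x y (λ (s , s∈ , r) → x∉ (s , S⊆S′ s∈ , r)) (λ (s , s∈ , r) → y∉ (s , S⊆S′ s∈ , r))

  IsolatingEdges : List (Edge G) → Set
  IsolatingEdges Es = IsolatingMid G (map mid Es)

  isolating-edges : IsolatingEdges edges
  isolating-edges (inj₁ u) (inj₁ v) _   _   ()
  isolating-edges (inj₁ v) (inj₂ e) _   e∉ _ = e∉ (mid e , ∈-map⁺ mid (∈-edges e) , inj₁ refl)
  isolating-edges (inj₂ e) y        e∉ _   _ = e∉ (mid e , ∈-map⁺ mid (∈-edges e) , inj₁ refl)

  N[v]⊆N[mₑ] : ∀ {v e x} → v ∈ᴱ e → (inj₁ v ≡ x) ⊎ Adj (inj₁ v) x → (mid e ≡ x) ⊎ Adj (mid e) x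
  N[v]⊆N[mₑ] v∈e (inj₁ refl) = inj₂ v∈e
  N[v]⊆N[mₑ] {v} {e} {inj₂ f} v∈e (inj₂ v∈f) with e ≟ᴱ f
  ... | yes refl = inj₁ refl
  ... | no  e≢f  = inj₂ (e≢f , v , v∈e , v∈f)

  N[v]-independent : ∀ {v x y} → ¬ ∃ (v ∈ᴱ_) → (inj₁ v ≡ x) ⊎ Adj (inj₁ v) x → ¬ Adj x y
  N[v]-independent {y = inj₂ f} isolated (inj₁ refl) v∈f = isolated (f , v∈f)
  N[v]-independent {x = inj₂ f} isolated (inj₂ v∈f) _   = isolated (f , v∈f)

  incidentEdge? : ∀ v → Dec (∃ (v ∈ᴱ_))
  incidentEdge? v with any? (v ∈ᴱ?_) edges
  ... | yes e∈ = let e , _ , v∈e = find e∈ in yes (e , v∈e)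
  ... | no  e∉ = no λ (e , v∈e) → e∉ (lose (∈-edges e) v∈e)

  edgeChoice : ∀ {v} → Dec (∃ (v ∈ᴱ_)) → List (Edge G)
  edgeChoice (yes (e , _)) = e ∷ []
  edgeChoice (no  _)       = []

  edgeChoice-spec : ∀ {v} (d : Dec (∃ (v ∈ᴱ_))) → (∃ λ e → e ∈ edgeChoice d × v ∈ᴱ e) ⊎ ¬ ∃ (v ∈ᴱ_)
  edgeChoice-spec (yes (e , v∈e)) = inj₁ (e , here refl , v∈e)
  edgeChoice-spec (no  isolated)  = inj₂ isolated

  toEdges : MidV G → List (Edge G)
  toEdges (inj₁ v) = edgeChoice (incidentEdge? v)
  toEdges (inj₂ e) = e ∷ []

  length-toEdges : ∀ x → length (toEdges x) ≤ 1
  length-toEdges (inj₁ v) with incidentEdge? v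
  ... | yes _ = s≤s z≤n
  ... | no  _ = z≤n
  length-toEdges (inj₂ e) = s≤s z≤n

  edgesOf : List (MidV G) → List (Edge G)
  edgesOf = concatMap toEdges

  length-edgesOf : ∀ S → length (edgesOf S) ≤ length S
  length-edgesOf []      = z≤n
  length-edgesOf (x ∷ S) = ≤-trans (≤-reflexive (length-++ (toEdges x)))
                                   (+-mono-≤ (length-toEdges x) (length-edgesOf S))

  ∈-edgesOf : ∀ {S x e} → x ∈ S → e ∈ toEdges x → e ∈ edgesOf S
  ∈-edgesOf x∈S e∈ = ∈-concatMap⁺ toEdges (lose x∈S e∈)

  N[edgesOf] : ∀ S {x y} → N[ S ] x → Adj x y → N[ map mid (edgesOf S) ] x
  N[edgesOf] S (inj₂ e , e∈S , r) _ = mid e , ∈-map⁺ mid (∈-edgesOf e∈S (here refl)) , r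
  N[edgesOf] S (inj₁ v , v∈S , r) x~y with edgeChoice-spec (incidentEdge? v)
  ... | inj₁ (e , e∈ , v∈e) = mid e , ∈-map⁺ mid (∈-edgesOf v∈S e∈) , N[v]⊆N[mₑ] v∈e r
  ... | inj₂ isolated       = ⊥-elim (N[v]-independent isolated r x~y)

  isolating-edgesOf : ∀ S → IsolatingMid G S → IsolatingEdges (edgesOf S)
  isolating-edgesOf S iso x y x∉ y∉ x~y =
    iso x y (λ x∈ → x∉ (N[edgesOf] S x∈ x~y)) (λ y∈ → y∉ (N[edgesOf] S y∈ (adj-sym x~y))) x~y

  isolating-deduplicate : ∀ {Es} → IsolatingEdges Es → IsolatingEdges (deduplicate _≟ᴱ_ Es)
  isolating-deduplicate = isolating-⊆ (⊆-map⁺ mid (∈-deduplicate⁺ _≟ᴱ_))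

  -- By isolating-edgesOf, a shortest isolating edge list has length at most
  -- length edges, so it suffices to search the words over edges up to that length.
  candidates : List (List (Edge G))
  candidates = filter (isolating? ∘ map mid) (wordsUpTo edges (length edges))

  ∈-candidates : ∀ {Es} → IsolatingEdges Es → length Es ≤ length edges → Es ∈ candidates
  ∈-candidates iso short =
    ∈-filter⁺ (isolating? ∘ map mid) (∈-wordsUpTo (All.tabulate λ {e} _ → ∈-edges e) short) iso

  shortest : List (Edge G)
  shortest = argmin length edges candidates

  isolating-shortest : IsolatingEdges shortest
  isolating-shortest = argmin-all length {P = IsolatingEdges} isolating-edges
                         (all-filter (isolating? ∘ map mid) (wordsUpTo edges (length edges)))

  shortest-≤ : ∀ Es → IsolatingEdges Es → length shortest ≤ length Es
  shortest-≤ Es iso with length Es ≤? length edges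
  ... | yes short = All.lookup (f[argmin]≤f[xs] {f = length} edges candidates) (∈-candidates iso short)
  ... | no  long  = ≤-trans (f[argmin]≤f[⊤] {f = length} edges candidates) (<⇒≤ (≰⇒> long))

  shortest-minimal : ∀ S → IsolatingMid G S → length shortest ≤ length S
  shortest-minimal S iso = ≤-trans (shortest-≤ (edgesOf S) (isolating-edgesOf S iso)) (length-edgesOf S)

lemma1 : ∀ {n} (G : Graph n) →
    ∃ λ (E₀ : List (Edge G)) → Unique E₀ × IsMinIsolatingMid G (map (m {G = G}) E₀)
lemma1 G = E₀ , E₀-unique , Unique-map⁺ inj₂-injective E₀-unique ,
           isolating-deduplicate isolating-shortest , minimal
  where
  open MiddleGraph G

  E₀ : List (Edge G)
  E₀ = deduplicate _≟ᴱ_ shortest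

  E₀-unique : Unique E₀
  E₀-unique = deduplicate-! _≟ᴱ_ shortest

  minimal : ∀ S → Unique S → IsolatingMid G S → length (map mid E₀) ≤ length S
  minimal S _ iso = ≤-trans (≤-reflexive (length-map mid E₀))
                      (≤-trans (length-deduplicate _≟ᴱ_ shortest) (shortest-minimal S iso))
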